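{- Let $Q$ be an IPC formula, $N \in \mathbb{N}$ and $Z_N, \dots, Z_0$ IPC formulas. Then $\mathcal{D}(Z_N, \dots, Z_0) \vdash QZ_0 \vee \cdots \vee QZ_N$, where the iterated disjunction is bracketed to the left: $D_0 = QZ_0$ and $D_{k+1} = D_k \vee QZ_{k+1}$, and $QZ_0 \vee \cdots \vee QZ_N$ denotes $D_N$.
   Context: The Implicational Propositional Calculus (IPC) has formulas built from propositional variables using only $\supset$, the single inference rule modus ponens, and the axiom schemes $X \supset (Y \supset X)$, $[X \supset (Y \supset Z)] \supset [(X \supset Y) \supset (X \supset Z)]$ and $[(X \supset Y) \supset X] \supset X$. $\Gamma \vdash X$ means $X$ is deducible in IPC from hypotheses $\Gamma$. For an IPC formula $Z$ write $QZ := Z \supset Q$. Disjunction is the abbreviation $X \vee Y := (X \supset Y) \supset Y$. For a sequence $\theta = (Z_N, \dots, Z_0)$ of IPC formulas, $\mathcal{D}(\theta) := Z_N \supset (Z_{N-1} \supset ( \cdots (Z_0 \supset Q) \cdots ))$; equivalently $\mathcal{D}(Z_0) = Z_0 \supset Q$ and $\mathcal{D}(W, \theta) = W \supset \mathcal{D}(\theta)$. -}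

module Defs where

open import Data.Nat using (ℕ; zero; suc)
open import Data.Fin using (Fin; zero; suc; fromℕ; inject₁)
open import Data.List using (List; []; _∷_)
open import Data.List.Membership.Propositional using (_∈_)

data Formula : Set where
  var : ℕ → Formula
  _⊃_ : Formula → Formula → Formula

infixr 5 _⊃_

data _⊢_ (Γ : List Formula) : Formula → Set where
  ax1 : ∀ {X Y} → Γ ⊢ (X ⊃ (Y ⊃ X))
  ax2 : ∀ {X Y Z} → Γ ⊢ ((X ⊃ (Y ⊃ Z)) ⊃ ((X ⊃ Y) ⊃ (X ⊃ Z)))
  ax3 : ∀ {X Y} → Γ ⊢ (((X ⊃ Y) ⊃ X) ⊃ X)
  hyp : ∀ {X} → X ∈ Γ → Γ ⊢ X
  mp  : ∀ {X Y} → Γ ⊢ (X ⊃ Y) → Γ ⊢ X → Γ ⊢ Y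

infix 3 _⊢_

_∨_ : Formula → Formula → Formula
X ∨ Y = (X ⊃ Y) ⊃ Y

QF : Formula → Formula → Formula
QF Q Z = Z ⊃ Q

-- A sequence (Z_N, ..., Z_0) is represented as Z : Fin (suc N) → Formula,
-- with Z i standing for Z_i.
-- 𝒟(Z_N, ..., Z_0) = Z_N ⊃ (Z_{N-1} ⊃ ( ... (Z_0 ⊃ Q) ... )).
-- 𝒟-upto Q Z k builds Z_k ⊃ ( ... (Z_0 ⊃ Q)) for k ≤ N, via recursion on k.
𝒟 : Formula → (N : ℕ) → (Fin (suc N) → Formula) → Formula
𝒟 Q zero    Z = Z zero ⊃ Q
𝒟 Q (suc N) Z = Z (fromℕ (suc N)) ⊃ 𝒟 Q N (λ i → Z (inject₁ i))

disjQ : Formula → (N : ℕ) → (Fin (suc N) → Formula) → Formula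
disjQ Q zero    Z = QF Q (Z zero)
disjQ Q (suc N) Z = disjQ Q N (λ i → Z (inject₁ i)) ∨ QF Q (Z (fromℕ (suc N)))

module Submission where

-- Write θ = (Z_N, …, Z_0) and D_N for the left-bracketed
-- disjunction QZ_0 ∨ ⋯ ∨ QZ_N.  We show the stronger, context-independent
-- statement "Γ ⊢ 𝒟(θ) implies Γ ⊢ D_N" by induction on N.  For the step, 𝒟(Z_{N+1}, θ) = Z_{N+1} ⊃ 𝒟(θ) and
-- D_{N+1} = (D_N ⊃ QZ_{N+1}) ⊃ QZ_{N+1}: assuming D_N ⊃ QZ_{N+1} and Z_{N+1},
-- we get 𝒟(θ), hence D_N by induction, hence QZ_{N+1}, hence Q.

open import Defs
open import Data.Nat using (ℕ; suc; zero)
open import Data.Fin using (Fin; inject₁)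
open import Data.List using (_∷_; [_])
open import Data.List.Relation.Unary.Any using (here; there)
open import Relation.Binary.PropositionalEquality using (refl)

weaken : ∀ {Γ X A} → Γ ⊢ A → X ∷ Γ ⊢ A
weaken ax1      = ax1
weaken ax2      = ax2
weaken ax3      = ax3
weaken (hyp p)  = hyp (there p)
weaken (mp f a) = mp (weaken f) (weaken a)

identity : ∀ {Γ X} → Γ ⊢ X ⊃ X
identity {X = X} = mp (mp (ax2 {Y = X ⊃ X}) ax1) (ax1 {Y = X})

deduction : ∀ {Γ X Y} → X ∷ Γ ⊢ Y → Γ ⊢ X ⊃ Y
deduction ax1               = mp ax1 ax1
deduction ax2               = mp ax1 ax2
deduction ax3               = mp ax1 ax3
deduction (hyp (here refl)) = identity
deduction (hyp (there p))   = mp ax1 (hyp p)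
deduction (mp f a)          = mp (mp ax2 (deduction f)) (deduction a)

∨-intro-conditional : ∀ {Γ W X D Y} →
  (∀ {Δ} → Δ ⊢ X → Δ ⊢ D) → Γ ⊢ W ⊃ X → Γ ⊢ D ∨ (W ⊃ Y)
∨-intro-conditional entails w⊃x =
  deduction (deduction (mp (mp d⊃w⊃y (entails x)) w))
  where
    w      = hyp (here refl)
    d⊃w⊃y  = hyp (there (here refl))
    x      = mp (weaken (weaken w⊃x)) w

𝒟-entails-disjQ : ∀ {Γ} (Q : Formula) (N : ℕ) (Z : Fin (suc N) → Formula) →
  Γ ⊢ 𝒟 Q N Z → Γ ⊢ disjQ Q N Z
𝒟-entails-disjQ Q zero    Z d = d
𝒟-entails-disjQ Q (suc N) Z d =
  ∨-intro-conditional (𝒟-entails-disjQ Q N (λ i → Z (inject₁ i))) d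

theorem6 : (Q : Formula) (N : ℕ) (Z : Fin (suc N) → Formula) →
    [ 𝒟 Q N Z ] ⊢ disjQ Q N Z
theorem6 Q N Z = 𝒟-entails-disjQ Q N Z (hyp (here refl))
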